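{- Let $G$ be a global amoeba which is the vertex-disjoint union $G=H'\cup H''$ of two subgraphs $H'$ and $H''$ with $E(G)=E(H')\cup E(H'')$ ($H''$ is allowed to be the null graph, in which case $G=H'$). Let $H$ be a copy of $H'$ that is vertex-disjoint from $G$. Then: (i) for any $e\in E(\overline H)$, the graph $G\cup(H+e)$ is a global amoeba; (ii) for any $e\in E(H)$, the graph $G\cup(H-e)$ is a global amoeba.
   Context: For a graph $G$ on vertex set $V=\{v_1,\dots,v_n\}$ let $L_G=\{ij: v_iv_j\in E(G)\}$; for $\sigma\in S_n$, $G_\sigma$ is the graph on $V$ with $E(G_\sigma)=\{v_{\sigma^{ -1}(i)}v_{\sigma^{ -1}(j)}: ij\in L_G\}$. An edge-replacement $e\to e'$ ($e\in E(G)$, $e'\in E(\overline G)\cup\{e\}$) is feasible if $G-e+e'\cong G$. Let $R_G$ be the set of feasible replacements $rs\to kl$ (meaning $v_rv_s\to v_kv_l$), $S_G(rs\to kl)=\{\sigma\in S_n: G_\sigma=G-v_rv_s+v_kv_l\}$, and $S_G\le S_n$ the group generated by $\bigcup_{rs\to kl\in R_G}S_G(rs\to kl)$. $G$ is a local amoeba if $S_G=S_n$; $G$ is a global amoeba if there is $T\ge0$ such that $G\cup tK_1$ ($G$ plus $t$ isolated vertices) is a local amoeba for all $t\ge T$. -}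

module Defs where

open import Data.Nat using (ℕ; _+_; _≤_)
open import Data.Bool using (Bool; true; false; _∧_; _∨_; not)
open import Data.Bool.Properties using (∨-comm; ∧-zeroʳ; ∨-identityʳ)
open import Data.Fin using (Fin; _≟_; splitAt)
open import Data.Fin.Permutation using (Permutation; Permutation′; _⟨$⟩ʳ_; id; flip; _∘ₚ_)
open import Data.Sum using (_⊎_; inj₁; inj₂)
open import Data.Product using (Σ; ∃; _×_; _,_)
open import Relation.Nullary using (¬_; yes; no)
open import Relation.Nullary.Decidable using (⌊_⌋)
open import Relation.Binary.PropositionalEquality using (_≡_; refl; sym; trans; cong; cong₂)

-- Finite simple graphs on vertex set Fin n  (vertex v_i is the element i)

record Graph (n : ℕ) : Set where
  field
    adj    : Fin n → Fin n → Bool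
    adj-sym    : ∀ x y → adj x y ≡ adj y x
    adj-irrefl : ∀ x → adj x x ≡ false
open Graph public

IsEdge : ∀ {n} → Graph n → Fin n → Fin n → Set
IsEdge G x y = adj G x y ≡ true

IsNonEdge : ∀ {n} → Graph n → Fin n → Fin n → Set
IsNonEdge G x y = ¬ (x ≡ y) × adj G x y ≡ false

eqb : ∀ {n} → Fin n → Fin n → Bool
eqb x y = ⌊ x ≟ y ⌋

eqb-sym : ∀ {n} (x y : Fin n) → eqb x y ≡ eqb y x
eqb-sym x y with x ≟ y | y ≟ x
... | yes _ | yes _ = refl
... | no _  | no _  = refl
... | yes p | no q  with q (sym p)
... | ()
eqb-sym x y | no p | yes q with p (sym q)
... | ()

eqb-refl : ∀ {n} (x : Fin n) → eqb x x ≡ true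
eqb-refl x with x ≟ x
... | yes _ = refl
... | no p with p refl
... | ()

edgeIs : ∀ {n} → Fin n → Fin n → Fin n → Fin n → Bool
edgeIs r s x y = not (eqb x y) ∧ ((eqb r x ∧ eqb s y) ∨ (eqb r y ∧ eqb s x))

edgeIs-sym : ∀ {n} (r s x y : Fin n) → edgeIs r s x y ≡ edgeIs r s y x
edgeIs-sym r s x y =
  cong₂ _∧_ (cong not (eqb-sym x y))
            (∨-comm (eqb r x ∧ eqb s y) (eqb r y ∧ eqb s x))

edgeIs-irrefl : ∀ {n} (r s x : Fin n) → edgeIs r s x x ≡ false
edgeIs-irrefl r s x rewrite eqb-refl x = refl

addEdge : ∀ {n} → Graph n → Fin n → Fin n → Graph n
addEdge G k l = record
  { adj    = λ x y → edgeIs k l x y ∨ adj G x y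
  ; adj-sym    = λ x y → cong₂ _∨_ (edgeIs-sym k l x y) (Graph.adj-sym G x y)
  ; adj-irrefl = λ x → trans (cong₂ _∨_ (edgeIs-irrefl k l x) (Graph.adj-irrefl G x)) refl
  }

removeEdge : ∀ {n} → Graph n → Fin n → Fin n → Graph n
removeEdge G r s = record
  { adj    = λ x y → not (edgeIs r s x y) ∧ adj G x y
  ; adj-sym    = λ x y → cong₂ (λ a b → not a ∧ b) (edgeIs-sym r s x y) (Graph.adj-sym G x y)
  ; adj-irrefl = λ x → trans (cong₂ (λ a b → not a ∧ b) refl (Graph.adj-irrefl G x))
                         (∧-zeroʳ (not (edgeIs r s x x)))
  }

_[_] : ∀ {n} → Graph n → Permutation′ n → Graph n
G [ σ ] = record
  { adj    = λ x y → adj G (σ ⟨$⟩ʳ x) (σ ⟨$⟩ʳ y)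
  ; adj-sym    = λ x y → Graph.adj-sym G (σ ⟨$⟩ʳ x) (σ ⟨$⟩ʳ y)
  ; adj-irrefl = λ x → Graph.adj-irrefl G (σ ⟨$⟩ʳ x)
  }

_≗G_ : ∀ {n} → Graph n → Graph n → Set
G ≗G K = ∀ x y → adj G x y ≡ adj K x y

_≅_ : ∀ {m n} → Graph m → Graph n → Set
_≅_ {m} {n} G K = Σ (Permutation m n) λ f → ∀ x y → adj G x y ≡ adj K (f ⟨$⟩ʳ x) (f ⟨$⟩ʳ y)

Feasible : ∀ {n} → Graph n → Fin n → Fin n → Fin n → Fin n → Set
Feasible G r s k l =
  IsEdge G r s
  × (IsNonEdge G k l ⊎ ((k ≡ r × l ≡ s) ⊎ (k ≡ s × l ≡ r)))
  × (addEdge (removeEdge G r s) k l ≅ G)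

InSG : ∀ {n} → Graph n → Fin n → Fin n → Fin n → Fin n → Permutation′ n → Set
InSG G r s k l σ = (G [ σ ]) ≗G addEdge (removeEdge G r s) k l

Generator : ∀ {n} → Graph n → Permutation′ n → Set
Generator {n} G σ =
  Σ (Fin n) λ r → Σ (Fin n) λ s → Σ (Fin n) λ k → Σ (Fin n) λ l →
    Feasible G r s k l × InSG G r s k l σ

-- subgroup of S_n generated by a set P of permutations
-- (permutations are identified up to pointwise equality)
data Generated {n : ℕ} (P : Permutation′ n → Set) : Permutation′ n → Set where
  gen  : ∀ {σ} → P σ → Generated P σ
  one  : Generated P id
  comp : ∀ {σ τ} → Generated P σ → Generated P τ → Generated P (σ ∘ₚ τ)
  inv  : ∀ {σ} → Generated P σ → Generated P (flip σ)
  ext  : ∀ {σ τ} → (∀ i → σ ⟨$⟩ʳ i ≡ τ ⟨$⟩ʳ i) → Generated P σ → Generated P τ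

LocalAmoeba : ∀ {n} → Graph n → Set
LocalAmoeba G = ∀ π → Generated (Generator G) π

unionAdj : ∀ {m n} → Graph m → Graph n → Fin m ⊎ Fin n → Fin m ⊎ Fin n → Bool
unionAdj G K (inj₁ x) (inj₁ y) = adj G x y
unionAdj G K (inj₂ x) (inj₂ y) = adj K x y
unionAdj G K (inj₁ x) (inj₂ y) = false
unionAdj G K (inj₂ x) (inj₁ y) = false

unionAdj-sym : ∀ {m n} (G : Graph m) (K : Graph n) u v → unionAdj G K u v ≡ unionAdj G K v u
unionAdj-sym G K (inj₁ x) (inj₁ y) = Graph.adj-sym G x y
unionAdj-sym G K (inj₂ x) (inj₂ y) = Graph.adj-sym K x y
unionAdj-sym G K (inj₁ x) (inj₂ y) = refl
unionAdj-sym G K (inj₂ x) (inj₁ y) = refl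

unionAdj-irrefl : ∀ {m n} (G : Graph m) (K : Graph n) u → unionAdj G K u u ≡ false
unionAdj-irrefl G K (inj₁ x) = Graph.adj-irrefl G x
unionAdj-irrefl G K (inj₂ x) = Graph.adj-irrefl K x

_⊕_ : ∀ {m n} → Graph m → Graph n → Graph (m + n)
_⊕_ {m} G K = record
  { adj    = λ x y → unionAdj G K (splitAt m x) (splitAt m y)
  ; adj-sym    = λ x y → unionAdj-sym G K (splitAt m x) (splitAt m y)
  ; adj-irrefl = λ x → unionAdj-irrefl G K (splitAt m x)
  }

isolated : (t : ℕ) → Graph t
isolated t = record { adj = λ _ _ → false ; adj-sym = λ _ _ → refl ; adj-irrefl = λ _ → refl }

GlobalAmoeba : ∀ {n} → Graph n → Set
GlobalAmoeba G = ∃ λ T → ∀ t → T ≤ t → LocalAmoeba (G ⊕ isolated t)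

module Submission where

-- Both parts are one statement: H + e and H − e are `toggle H k l`, the graph H
-- with the pair e = kl flipped. Up to isomorphism, G ∪ (H ± e) ∪ tK₁ is
-- F = (H ± e) ∪ (H ∪ R) with R = H″ ∪ tK₁, and H ∪ R ≅ G ∪ tK₁ is a local
-- amoeba. The permutation τ exchanging the two copies of H maps F to F with e
-- moved from one copy to the other, so τ lies in S_F (swap-generator).
-- Generators of S_{H ∪ R} act on the last two blocks of F
-- (lift-transposition); conjugating them by τ, and by each other, produces
-- every transposition, so S_F is the whole symmetric group provided R has a
-- vertex (swap-amoeba) — this is why one more isolated vertex is required.
-- Invariance of local amoebas under isomorphism (amoeba-transfer) transports
-- everything back to the graphs of the statement.

open import Defs
open import Data.Nat using (ℕ; suc; _+_; s≤s)
open import Data.Nat.Properties using (m≤n⇒m≤1+n)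
open import Data.Bool using (Bool; true; false; _∧_; _∨_; not; _xor_)
open import Data.Bool.Properties using (∧-zeroʳ; not-involutive)
open import Data.Empty using (⊥-elim)
open import Data.Fin using (Fin; _≟_; splitAt; join; _↑ˡ_; _↑ʳ_) renaming (zero to fzero)
open import Data.Fin.Properties using (+↔⊎; splitAt-join; splitAt-↑ˡ; splitAt-↑ʳ; ↑ˡ-injective; ↑ʳ-injective; splitAt⁻¹-↑ˡ; splitAt⁻¹-↑ʳ)
open import Data.Fin.Permutation using (Permutation; Permutation′; _⟨$⟩ʳ_; _⟨$⟩ˡ_; id; flip; _∘ₚ_; _≈_; transpose; permutation; inverseˡ; inverseʳ)
import Data.Fin.Permutation.Components as PC
open import Data.Fin.Permutation.Transposition.List using (eval; decompose; eval-decompose)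
open import Data.List using ([]; _∷_)
open import Data.Product using (∃; _×_; _,_; proj₁)
open import Data.Sum using (_⊎_; inj₁; inj₂; [_,_]′)
open import Data.Sum.Algebra using (⊎-comm; ⊎-assoc)
open import Data.Sum.Function.Propositional using (_⊎-↔_)
open import Function.Bundles using (_↔_; Inverse; Injection)
open import Function.Definitions using (Injective)
open import Function.Properties.Inverse using (↔-trans; ↔-sym; ↔⇒↣)
open import Relation.Nullary using (¬_; yes; no; Dec)
open import Relation.Binary.PropositionalEquality using (_≡_; refl; sym; trans; cong; cong₂; subst; subst₂; module ≡-Reasoning)

eqb-true : ∀ {n} {x y : Fin n} → eqb x y ≡ true → x ≡ y
eqb-true {x = x} {y} e with x ≟ y
... | yes x≡y = x≡y
eqb-true () | no _

eqb-false : ∀ {n} {x y : Fin n} → ¬ x ≡ y → eqb x y ≡ false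
eqb-false {x = x} {y} x≢y with x ≟ y
... | yes x≡y = ⊥-elim (x≢y x≡y)
... | no _    = refl

eqb-map : ∀ {m n} (g : Fin m → Fin n) → Injective _≡_ _≡_ g →
          ∀ x y → eqb (g x) (g y) ≡ eqb x y
eqb-map g g-inj x y with x ≟ y
... | yes refl = eqb-refl (g x)
... | no x≢y   = eqb-false (λ e → x≢y (g-inj e))

edgeIs-map : ∀ {m n} (g : Fin m → Fin n) → Injective _≡_ _≡_ g →
             ∀ r s x y → edgeIs (g r) (g s) (g x) (g y) ≡ edgeIs r s x y
edgeIs-map g g-inj r s x y =
  cong₂ (λ a b → not a ∧ b) (same x y)
        (cong₂ _∨_ (cong₂ _∧_ (same r x) (same s y)) (cong₂ _∧_ (same r y) (same s x)))
  where same = eqb-map g g-inj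

disjunct-true : ∀ a b c d e → not a ∧ ((b ∧ c) ∨ (d ∧ e)) ≡ true →
                (b ≡ true × c ≡ true) ⊎ (d ≡ true × e ≡ true)
disjunct-true true  _     _     _     _     ()
disjunct-true false true  true  _     _     _  = inj₁ (refl , refl)
disjunct-true false true  false true  true  _  = inj₂ (refl , refl)
disjunct-true false true  false true  false ()
disjunct-true false true  false false _     ()
disjunct-true false false _     true  true  _  = inj₂ (refl , refl)
disjunct-true false false _     true  false ()
disjunct-true false false _     false _     ()

edgeIs-true : ∀ {n} {k l x y : Fin n} → edgeIs k l x y ≡ true →
              (k ≡ x × l ≡ y) ⊎ (k ≡ y × l ≡ x)
edgeIs-true {k = k} {l} {x} {y} e
  with disjunct-true (eqb x y) (eqb k x) (eqb l y) (eqb k y) (eqb l x) e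
... | inj₁ (p , q) = inj₁ (eqb-true p , eqb-true q)
... | inj₂ (p , q) = inj₂ (eqb-true p , eqb-true q)

edgeIs-self : ∀ {n} {k l : Fin n} → ¬ k ≡ l → edgeIs k l k l ≡ true
edgeIs-self {k = k} {l} k≢l rewrite eqb-false k≢l | eqb-refl k | eqb-refl l = refl

edgeIs-apartˡ : ∀ {n} {r s x : Fin n} y → ¬ x ≡ r → ¬ x ≡ s → edgeIs r s x y ≡ false
edgeIs-apartˡ {r = r} {s} {x} y x≢r x≢s
  rewrite eqb-false {x = r} {x} (λ e → x≢r (sym e))
        | eqb-false {x = s} {x} (λ e → x≢s (sym e))
        | ∧-zeroʳ (eqb r y)
  = ∧-zeroʳ (not (eqb x y))

edgeIs-apartʳ : ∀ {n} {r s y : Fin n} x → ¬ y ≡ r → ¬ y ≡ s → edgeIs r s x y ≡ false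
edgeIs-apartʳ {r = r} {s} {y} x y≢r y≢s = trans (edgeIs-sym r s x y) (edgeIs-apartˡ x y≢r y≢s)

on-pair : ∀ {n} (G : Graph n) {k l x y} → edgeIs k l x y ≡ true → adj G x y ≡ adj G k l
on-pair G {k} {l} {x} {y} e with edgeIs-true {k = k} {l} {x} {y} e
... | inj₁ (refl , refl) = refl
... | inj₂ (refl , refl) = Graph.adj-sym G _ _

edge-ends-distinct : ∀ {n} (G : Graph n) {k l} → IsEdge G k l → ¬ k ≡ l
edge-ends-distinct G {k} kl refl with trans (sym kl) (Graph.adj-irrefl G k)
... | ()

transpose-atˡ : ∀ {n} (i j : Fin n) → PC.transpose i j i ≡ j
transpose-atˡ i j with i ≟ i
... | yes _  = refl
... | no i≢i = ⊥-elim (i≢i refl)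

transpose-atʳ : ∀ {n} (i j : Fin n) → PC.transpose i j j ≡ i
transpose-atʳ i j with j ≟ i
... | yes j≡i = j≡i
... | no _ with j ≟ j
...   | yes _  = refl
...   | no j≢j = ⊥-elim (j≢j refl)

transpose-away : ∀ {n} {i j k : Fin n} → ¬ k ≡ i → ¬ k ≡ j → PC.transpose i j k ≡ k
transpose-away {i = i} {j} {k} k≢i k≢j with k ≟ i
... | yes k≡i = ⊥-elim (k≢i k≡i)
... | no _ with k ≟ j
...   | yes k≡j = ⊥-elim (k≢j k≡j)
...   | no _    = refl

transpose-comm : ∀ {n} (i j : Fin n) → transpose i j ≈ transpose j i
transpose-comm i j k = by-cases (k ≟ i) (k ≟ j)
  where
  by-cases : Dec (k ≡ i) → Dec (k ≡ j) → PC.transpose i j k ≡ PC.transpose j i k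
  by-cases (yes refl) _          = trans (transpose-atˡ k j) (sym (transpose-atʳ j k))
  by-cases (no k≢i)   (yes refl) = trans (transpose-atʳ i k) (sym (transpose-atˡ k i))
  by-cases (no k≢i)   (no k≢j)   = trans (transpose-away k≢i k≢j) (sym (transpose-away k≢j k≢i))

transpose-natural : ∀ {m n} (g : Fin m → Fin n) → Injective _≡_ _≡_ g →
                    ∀ i j k → PC.transpose (g i) (g j) (g k) ≡ g (PC.transpose i j k)
transpose-natural g g-inj i j k = by-cases (k ≟ i) (k ≟ j)
  where
  by-cases : Dec (k ≡ i) → Dec (k ≡ j) → PC.transpose (g i) (g j) (g k) ≡ g (PC.transpose i j k)
  by-cases (yes refl) _          = trans (transpose-atˡ (g k) (g j)) (cong g (sym (transpose-atˡ k j)))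
  by-cases (no k≢i)   (yes refl) = trans (transpose-atʳ (g i) (g k)) (cong g (sym (transpose-atʳ i k)))
  by-cases (no k≢i)   (no k≢j)   =
    trans (transpose-away (λ e → k≢i (g-inj e)) (λ e → k≢j (g-inj e)))
          (cong g (sym (transpose-away k≢i k≢j)))

permutation-injective : ∀ {m n} (π : Permutation m n) → Injective _≡_ _≡_ (π ⟨$⟩ʳ_)
permutation-injective π = Injection.injective (↔⇒↣ π)

module _ {n : ℕ} {P : Permutation′ n → Set} where

  generated-by-transpositions : (∀ i j → Generated P (transpose i j)) → ∀ π → Generated P π
  generated-by-transpositions T π = ext (eval-decompose π) (product (decompose π))
    where
    product : ∀ ts → Generated P (eval ts)
    product []             = one
    product ((i , j) ∷ ts) = comp (T i j) (product ts)

  conjugate : ∀ {σ i j} → Generated P σ → Generated P (transpose i j) →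
              Generated P (transpose (σ ⟨$⟩ʳ i) (σ ⟨$⟩ʳ j))
  conjugate {σ} {i} {j} gσ gt = ext agree (comp (comp (inv gσ) gt) gσ)
    where
    open ≡-Reasoning
    agree : ∀ x → σ ⟨$⟩ʳ PC.transpose i j (σ ⟨$⟩ˡ x) ≡ PC.transpose (σ ⟨$⟩ʳ i) (σ ⟨$⟩ʳ j) x
    agree x = begin
      σ ⟨$⟩ʳ PC.transpose i j (σ ⟨$⟩ˡ x)
        ≡⟨ transpose-natural (σ ⟨$⟩ʳ_) (permutation-injective σ) i j (σ ⟨$⟩ˡ x) ⟨
      PC.transpose (σ ⟨$⟩ʳ i) (σ ⟨$⟩ʳ j) (σ ⟨$⟩ʳ (σ ⟨$⟩ˡ x))
        ≡⟨ cong (PC.transpose (σ ⟨$⟩ʳ i) (σ ⟨$⟩ʳ j)) (inverseʳ σ) ⟩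
      PC.transpose (σ ⟨$⟩ʳ i) (σ ⟨$⟩ʳ j) x ∎

  transpose-flip : ∀ {i j} → Generated P (transpose i j) → Generated P (transpose j i)
  transpose-flip {i} {j} = ext (transpose-comm i j)

record Homomorphism (m n : ℕ) : Set where
  field
    apply      : Permutation′ m → Permutation′ n
    apply-id   : id ≈ apply id
    apply-∘    : ∀ σ τ → apply σ ∘ₚ apply τ ≈ apply (σ ∘ₚ τ)
    apply-flip : ∀ σ → flip (apply σ) ≈ apply (flip σ)
    apply-cong : ∀ {σ τ} → σ ≈ τ → apply σ ≈ apply τ
open Homomorphism

image-generated : ∀ {m n} {P : Permutation′ m → Set} {Q : Permutation′ n → Set}
                  (h : Homomorphism m n) → (∀ {σ} → P σ → Generated Q (apply h σ)) →
                  ∀ {σ} → Generated P σ → Generated Q (apply h σ)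
image-generated h on-gen (gen p)             = on-gen p
image-generated h on-gen one                 = ext (apply-id h) one
image-generated h on-gen (comp {σ} {τ} g g′) =
  ext (apply-∘ h σ τ) (comp (image-generated h on-gen g) (image-generated h on-gen g′))
image-generated h on-gen (inv {σ} g)         = ext (apply-flip h σ) (inv (image-generated h on-gen g))
image-generated h on-gen (ext e g)           = ext (apply-cong h e) (image-generated h on-gen g)

replace : ∀ {n} → Graph n → Fin n → Fin n → Fin n → Fin n → Graph n
replace G r s k l = addEdge (removeEdge G r s) k l

Target : ∀ {n} → Graph n → Fin n → Fin n → Fin n → Fin n → Set
Target G r s k l = IsNonEdge G k l ⊎ ((k ≡ r × l ≡ s) ⊎ (k ≡ s × l ≡ r))

-- A permutation realising a replacement rs → kl is a generator of S_G;
-- feasibility of the replacement is witnessed by the permutation itself.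
generator : ∀ {n} {G : Graph n} {σ} r s k l → IsEdge G r s → Target G r s k l →
            InSG G r s k l σ → Generator G σ
generator {σ = σ} r s k l rs kl realises =
  r , s , k , l , (rs , kl , (σ , λ x y → sym (realises x y))) , realises

replace-away : ∀ {n} (F : Graph n) {r s k l x : Fin n} y →
               ¬ x ≡ r → ¬ x ≡ s → ¬ x ≡ k → ¬ x ≡ l → adj (replace F r s k l) x y ≡ adj F x y
replace-away F {r} {s} {k} {l} y x≢r x≢s x≢k x≢l
  rewrite edgeIs-apartˡ {r = k} {l} y x≢k x≢l | edgeIs-apartˡ {r = r} {s} y x≢r x≢s = refl

-- The same notion as _≅_, packaged as a record indexed by both graphs so
-- that Agda can infer them in chains of isomorphisms.
record Iso {m n} (G : Graph m) (K : Graph n) : Set where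
  constructor iso
  field
    bijection : Permutation m n
    preserves : ∀ x y → adj G x y ≡ adj K (bijection ⟨$⟩ʳ x) (bijection ⟨$⟩ʳ y)

≅⇒Iso : ∀ {m n} {G : Graph m} {K : Graph n} → G ≅ K → Iso G K
≅⇒Iso (f , pres) = iso f pres

≗⇒Iso : ∀ {n} {G K : Graph n} → G ≗G K → Iso G K
≗⇒Iso G≗K = iso id G≗K

≃-sym : ∀ {m n} {G : Graph m} {K : Graph n} → Iso G K → Iso K G
≃-sym {G = G} {K} (iso f pres) = iso (flip f) λ x y →
  trans (cong₂ (adj K) (sym (inverseʳ f)) (sym (inverseʳ f))) (sym (pres (f ⟨$⟩ˡ x) (f ⟨$⟩ˡ y)))

infixr 2 _≃⟨_⟩_
infix  3 _≃∎

_≃⟨_⟩_ : ∀ {m n o} (G : Graph m) {K : Graph n} {L : Graph o} → Iso G K → Iso K L → Iso G L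
G ≃⟨ iso f p ⟩ iso g q = iso (f ∘ₚ g) λ x y → trans (p x y) (q _ _)

_≃∎ : ∀ {n} (G : Graph n) → Iso G G
G ≃∎ = ≗⇒Iso λ _ _ → refl

⊕-adjˡˡ : ∀ {m n} (G : Graph m) (K : Graph n) a a′ → adj (G ⊕ K) (a ↑ˡ n) (a′ ↑ˡ n) ≡ adj G a a′
⊕-adjˡˡ {m} {n} G K a a′ rewrite splitAt-↑ˡ m a n | splitAt-↑ˡ m a′ n = refl

⊕-adjʳʳ : ∀ {m n} (G : Graph m) (K : Graph n) b b′ → adj (G ⊕ K) (m ↑ʳ b) (m ↑ʳ b′) ≡ adj K b b′
⊕-adjʳʳ {m} {n} G K b b′ rewrite splitAt-↑ʳ m n b | splitAt-↑ʳ m n b′ = refl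

⊕-adjˡʳ : ∀ {m n} (G : Graph m) (K : Graph n) a b → adj (G ⊕ K) (a ↑ˡ n) (m ↑ʳ b) ≡ false
⊕-adjˡʳ {m} {n} G K a b rewrite splitAt-↑ˡ m a n | splitAt-↑ʳ m n b = refl

⊕-adjʳˡ : ∀ {m n} (G : Graph m) (K : Graph n) b a → adj (G ⊕ K) (m ↑ʳ b) (a ↑ˡ n) ≡ false
⊕-adjʳˡ {m} {n} G K b a rewrite splitAt-↑ˡ m a n | splitAt-↑ʳ m n b = refl

↑ˡ≢↑ʳ : ∀ {m n} (a : Fin m) (b : Fin n) → ¬ a ↑ˡ n ≡ m ↑ʳ b
↑ˡ≢↑ʳ {m} {n} a b e with trans (sym (splitAt-↑ˡ m a n)) (trans (cong (splitAt m) e) (splitAt-↑ʳ m n b))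
... | ()

data Side (m n : ℕ) : Fin (m + n) → Set where
  left  : (a : Fin m) → Side m n (a ↑ˡ n)
  right : (b : Fin n) → Side m n (m ↑ʳ b)

side : ∀ m n (x : Fin (m + n)) → Side m n x
side m n x with splitAt m x in eq
... | inj₁ a = subst (Side m n) (splitAt⁻¹-↑ˡ eq) (left a)
... | inj₂ b = subst (Side m n) (splitAt⁻¹-↑ʳ eq) (right b)

⊕-≗ʳ : ∀ {m n} (G : Graph m) {K K′ : Graph n} → K ≗G K′ → (G ⊕ K) ≗G (G ⊕ K′)
⊕-≗ʳ {m} G {K} {K′} K≗K′ x y = blockwise (splitAt m x) (splitAt m y)
  where
  blockwise : ∀ u v → unionAdj G K u v ≡ unionAdj G K′ u v
  blockwise (inj₁ _) (inj₁ _) = refl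
  blockwise (inj₁ _) (inj₂ _) = refl
  blockwise (inj₂ _) (inj₁ _) = refl
  blockwise (inj₂ b) (inj₂ b′) = K≗K′ b b′

⊕-iso : ∀ {m n m′ n′} {G : Graph m} {K : Graph n} {G′ : Graph m′} {K′ : Graph n′}
        (φ : (Fin m ⊎ Fin n) ↔ (Fin m′ ⊎ Fin n′)) →
        (∀ u v → unionAdj G K u v ≡ unionAdj G′ K′ (Inverse.to φ u) (Inverse.to φ v)) →
        Iso (G ⊕ K) (G′ ⊕ K′)
⊕-iso {m} {n} {m′} {n′} {G′ = G′} {K′} φ pres =
  iso (↔-trans +↔⊎ (↔-trans φ (↔-sym +↔⊎))) λ x y →
    trans (pres (splitAt m x) (splitAt m y))
          (sym (cong₂ (unionAdj G′ K′) (splitAt-join m′ n′ (Inverse.to φ (splitAt m x)))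
                                       (splitAt-join m′ n′ (Inverse.to φ (splitAt m y)))))

⊕-cong : ∀ {m n m′ n′} {G : Graph m} {K : Graph n} {G′ : Graph m′} {K′ : Graph n′} →
         Iso G G′ → Iso K K′ → Iso (G ⊕ K) (G′ ⊕ K′)
⊕-cong {G = G} {K} {G′} {K′} (iso f p) (iso g q) = ⊕-iso {G = G} {K} {G′} {K′} (f ⊎-↔ g) pres
  where
  pres : ∀ u v → unionAdj G K u v ≡ unionAdj G′ K′ (Inverse.to (f ⊎-↔ g) u) (Inverse.to (f ⊎-↔ g) v)
  pres (inj₁ a) (inj₁ a′) = p a a′
  pres (inj₁ _) (inj₂ _)  = refl
  pres (inj₂ _) (inj₁ _)  = refl
  pres (inj₂ b) (inj₂ b′) = q b b′

⊕-comm : ∀ {m n} (G : Graph m) (K : Graph n) → Iso (G ⊕ K) (K ⊕ G)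
⊕-comm {m} {n} G K = ⊕-iso {G = G} {K} {K} {G} φ pres
  where
  φ : (Fin m ⊎ Fin n) ↔ (Fin n ⊎ Fin m)
  φ = ⊎-comm _ _
  pres : ∀ u v → unionAdj G K u v ≡ unionAdj K G (Inverse.to φ u) (Inverse.to φ v)
  pres (inj₁ _) (inj₁ _) = refl
  pres (inj₁ _) (inj₂ _) = refl
  pres (inj₂ _) (inj₁ _) = refl
  pres (inj₂ _) (inj₂ _) = refl

⊕-assoc : ∀ {m n p} (G : Graph m) (K : Graph n) (L : Graph p) → Iso ((G ⊕ K) ⊕ L) (G ⊕ (K ⊕ L))
⊕-assoc {m} {n} {p} G K L =
  ⊕-iso {G = G ⊕ K} {L} {G} {K ⊕ L} φ pres
  where
  φ : (Fin (m + n) ⊎ Fin p) ↔ (Fin m ⊎ Fin (n + p))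
  φ = ↔-trans (+↔⊎ {m} {n} ⊎-↔ id) (↔-trans (⊎-assoc _ _ _ _) (id ⊎-↔ ↔-sym (+↔⊎ {n} {p})))
  pres : ∀ u v → unionAdj (G ⊕ K) L u v ≡ unionAdj G (K ⊕ L) (Inverse.to φ u) (Inverse.to φ v)
  pres (inj₁ u) (inj₁ u′) with splitAt m u | splitAt m u′
  ... | inj₁ _ | inj₁ _ = refl
  ... | inj₁ _ | inj₂ _ = refl
  ... | inj₂ _ | inj₁ _ = refl
  ... | inj₂ b | inj₂ b′ = sym (⊕-adjˡˡ K L b b′)
  pres (inj₁ u) (inj₂ z) with splitAt m u
  ... | inj₁ _ = refl
  ... | inj₂ b = sym (⊕-adjˡʳ K L b z)
  pres (inj₂ z) (inj₁ u) with splitAt m u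
  ... | inj₁ _ = refl
  ... | inj₂ b = sym (⊕-adjʳˡ K L z b)
  pres (inj₂ z) (inj₂ z′) = sym (⊕-adjʳʳ K L z z′)

record Embedding {m n} (K : Graph m) (L : Graph n) : Set where
  field
    ι           : Fin m → Fin n
    ι-injective : Injective _≡_ _≡_ ι
    ι-adj       : ∀ x y → adj L (ι x) (ι y) ≡ adj K x y

module _ {m n} {K : Graph m} {L : Graph n} (ε : Embedding K L) where
  open Embedding ε

  target-along : ∀ {r s k l} → Target K r s k l → Target L (ι r) (ι s) (ι k) (ι l)
  target-along (inj₁ (k≢l , kl∉K))    = inj₁ ((λ e → k≢l (ι-injective e)) , trans (ι-adj _ _) kl∉K)
  target-along (inj₂ (inj₁ (p , q))) = inj₂ (inj₁ (cong ι p , cong ι q))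
  target-along (inj₂ (inj₂ (p , q))) = inj₂ (inj₂ (cong ι p , cong ι q))

  replace-along : ∀ r s k l x y →
                  adj (replace L (ι r) (ι s) (ι k) (ι l)) (ι x) (ι y) ≡ adj (replace K r s k l) x y
  replace-along r s k l x y =
    cong₂ _∨_ (edgeIs-map ι ι-injective k l x y)
              (cong₂ (λ a b → not a ∧ b) (edgeIs-map ι ι-injective r s x y) (ι-adj x y))

  Untouched : Permutation′ n → Fin n → Set
  Untouched σ′ x = (∀ a → ¬ x ≡ ι a) × (∀ y → adj L (σ′ ⟨$⟩ʳ x) (σ′ ⟨$⟩ʳ y) ≡ adj L x y)

  extend-generator : ∀ {σ σ′} → Generator K σ →
                     (∀ a → σ′ ⟨$⟩ʳ ι a ≡ ι (σ ⟨$⟩ʳ a)) →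
                     (∀ x → (∃ λ a → ι a ≡ x) ⊎ Untouched σ′ x) →
                     Generator L σ′
  extend-generator {σ} {σ′} (r , s , k , l , (rs , kl , _) , realises) σ′-on-ι cover =
    generator {G = L} {σ′} (ι r) (ι s) (ι k) (ι l) (trans (ι-adj r s) rs) (target-along kl) realises′
    where
    open ≡-Reasoning
    F′ : Graph n
    F′ = replace L (ι r) (ι s) (ι k) (ι l)
    untouched : ∀ {x} y → Untouched σ′ x → adj L (σ′ ⟨$⟩ʳ x) (σ′ ⟨$⟩ʳ y) ≡ adj F′ x y
    untouched y (x∉ι , fixed) =
      trans (fixed y) (sym (replace-away L y (x∉ι r) (x∉ι s) (x∉ι k) (x∉ι l)))
    realises′ : InSG L (ι r) (ι s) (ι k) (ι l) σ′
    realises′ x y with cover x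
    ... | inj₂ x-untouched = untouched y x-untouched
    ... | inj₁ (a , refl) with cover y
    ...   | inj₂ y-untouched =
            trans (Graph.adj-sym L (σ′ ⟨$⟩ʳ ι a) (σ′ ⟨$⟩ʳ y))
                  (trans (untouched (ι a) y-untouched) (Graph.adj-sym F′ y (ι a)))
    ...   | inj₁ (b , refl) = begin
            adj L (σ′ ⟨$⟩ʳ ι a) (σ′ ⟨$⟩ʳ ι b)     ≡⟨ cong₂ (adj L) (σ′-on-ι a) (σ′-on-ι b) ⟩
            adj L (ι (σ ⟨$⟩ʳ a)) (ι (σ ⟨$⟩ʳ b))   ≡⟨ ι-adj _ _ ⟩
            adj K (σ ⟨$⟩ʳ a) (σ ⟨$⟩ʳ b)           ≡⟨ realises a b ⟩
            adj (replace K r s k l) a b           ≡⟨ replace-along r s k l a b ⟨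
            adj F′ (ι a) (ι b)                    ∎

-- Being a local amoeba is invariant under isomorphism: conjugation by
-- f : G ≅ K turns generators of S_K into generators of S_G.
amoeba-transfer : ∀ {m n} {G : Graph m} {K : Graph n} → Iso G K → LocalAmoeba K → LocalAmoeba G
amoeba-transfer {m} {n} {G} {K} (iso f pres) K-amoeba π =
  ext back (image-generated {P = Generator K} {Generator G} conj (λ {σ} → on-generator {σ})
                            (K-amoeba (flip f ∘ₚ π ∘ₚ f)))
  where
  conj : Homomorphism n m
  conj = record
    { apply      = λ σ → f ∘ₚ σ ∘ₚ flip f
    ; apply-id   = λ x → sym (inverseˡ f)
    ; apply-∘    = λ σ τ x → cong (λ z → f ⟨$⟩ˡ (τ ⟨$⟩ʳ z)) (inverseʳ f)
    ; apply-flip = λ σ x → refl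
    ; apply-cong = λ σ≈τ x → cong (f ⟨$⟩ˡ_) (σ≈τ _)
    }
  K↪G : Embedding K G
  K↪G = record
    { ι           = f ⟨$⟩ˡ_
    ; ι-injective = permutation-injective (flip f)
    ; ι-adj       = λ x y → trans (pres _ _) (cong₂ (adj K) (inverseʳ f) (inverseʳ f))
    }
  on-generator : ∀ {σ} → Generator K σ → Generated (Generator G) (apply conj σ)
  on-generator {σ} gσ = gen (extend-generator K↪G {σ} {apply conj σ} gσ
    (λ a → cong (λ z → f ⟨$⟩ˡ (σ ⟨$⟩ʳ z)) (inverseʳ f))
    (λ x → inj₁ (f ⟨$⟩ʳ x , inverseˡ f)))
  back : apply conj (flip f ∘ₚ π ∘ₚ f) ≈ π
  back x = trans (cong (λ z → f ⟨$⟩ˡ (f ⟨$⟩ʳ (π ⟨$⟩ʳ z))) (inverseˡ f)) (inverseˡ f)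

module _ {p m : ℕ} (B : Graph p) (K : Graph m) where

  liftʳ : Permutation′ m → Permutation′ (p + m)
  liftʳ σ = ↔-trans (+↔⊎ {p} {m}) (↔-trans (id ⊎-↔ σ) (↔-sym (+↔⊎ {p} {m})))

  liftʳ-left : ∀ σ a → liftʳ σ ⟨$⟩ʳ (a ↑ˡ m) ≡ a ↑ˡ m
  liftʳ-left σ a = cong (λ z → join p m (Inverse.to (id ⊎-↔ σ) z)) (splitAt-↑ˡ p a m)

  liftʳ-right : ∀ σ b → liftʳ σ ⟨$⟩ʳ (p ↑ʳ b) ≡ p ↑ʳ (σ ⟨$⟩ʳ b)
  liftʳ-right σ b = cong (λ z → join p m (Inverse.to (id ⊎-↔ σ) z)) (splitAt-↑ʳ p m b)

  liftʳ-hom : Homomorphism m (p + m)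
  liftʳ-hom = record
    { apply      = liftʳ
    ; apply-id   = unit
    ; apply-∘    = compose
    ; apply-flip = λ σ x → refl
    ; apply-cong = λ {σ} {τ} → congruent {σ} {τ}
    }
    where
    unit : id ≈ liftʳ id
    unit x with side p m x
    ... | left a  = sym (liftʳ-left id a)
    ... | right b = sym (liftʳ-right id b)
    compose : ∀ σ τ → liftʳ σ ∘ₚ liftʳ τ ≈ liftʳ (σ ∘ₚ τ)
    compose σ τ x with side p m x
    ... | left a  = trans (cong (liftʳ τ ⟨$⟩ʳ_) (liftʳ-left σ a))
                          (trans (liftʳ-left τ a) (sym (liftʳ-left (σ ∘ₚ τ) a)))
    ... | right b = trans (cong (liftʳ τ ⟨$⟩ʳ_) (liftʳ-right σ b))
                          (trans (liftʳ-right τ _) (sym (liftʳ-right (σ ∘ₚ τ) b)))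
    congruent : ∀ {σ τ} → σ ≈ τ → liftʳ σ ≈ liftʳ τ
    congruent {σ} {τ} σ≈τ x with side p m x
    ... | left a  = trans (liftʳ-left σ a) (sym (liftʳ-left τ a))
    ... | right b = trans (liftʳ-right σ b) (trans (cong (p ↑ʳ_) (σ≈τ b)) (sym (liftʳ-right τ b)))

  K↪B⊕K : Embedding K (B ⊕ K)
  K↪B⊕K = record
    { ι           = p ↑ʳ_
    ; ι-injective = ↑ʳ-injective p _ _
    ; ι-adj       = ⊕-adjʳʳ B K
    }

  left-untouched : ∀ σ a → Untouched K↪B⊕K (liftʳ σ) (a ↑ˡ m)
  left-untouched σ a = (λ b → ↑ˡ≢↑ʳ a b) , fixed
    where
    fixed : ∀ y → adj (B ⊕ K) (liftʳ σ ⟨$⟩ʳ (a ↑ˡ m)) (liftʳ σ ⟨$⟩ʳ y) ≡ adj (B ⊕ K) (a ↑ˡ m) y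
    fixed y with side p m y
    ... | left a′ = cong₂ (adj (B ⊕ K)) (liftʳ-left σ a) (liftʳ-left σ a′)
    ... | right b = trans (cong₂ (adj (B ⊕ K)) (liftʳ-left σ a) (liftʳ-right σ b))
                          (trans (⊕-adjˡʳ B K a _) (sym (⊕-adjˡʳ B K a b)))

  lift-generated : ∀ {σ} → Generated (Generator K) σ → Generated (Generator (B ⊕ K)) (liftʳ σ)
  lift-generated = image-generated {P = Generator K} {Generator (B ⊕ K)} liftʳ-hom λ {σ} gσ →
    gen (extend-generator K↪B⊕K {σ} {liftʳ σ} gσ (liftʳ-right σ) (cover σ))
    where
    cover : ∀ σ x → (∃ λ b → p ↑ʳ b ≡ x) ⊎ Untouched K↪B⊕K (liftʳ σ) x
    cover σ x with side p m x
    ... | left a  = inj₂ (left-untouched σ a)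
    ... | right b = inj₁ (b , refl)

  lift-transposition : ∀ {i j} → Generated (Generator K) (transpose i j) →
                       Generated (Generator (B ⊕ K)) (transpose (p ↑ʳ i) (p ↑ʳ j))
  lift-transposition {i} {j} g = ext agree (lift-generated g)
    where
    agree : ∀ x → liftʳ (transpose i j) ⟨$⟩ʳ x ≡ PC.transpose (p ↑ʳ i) (p ↑ʳ j) x
    agree x with side p m x
    ... | left a  = trans (liftʳ-left (transpose i j) a)
                          (sym (transpose-away (↑ˡ≢↑ʳ a i) (↑ˡ≢↑ʳ a j)))
    ... | right b = trans (liftʳ-right (transpose i j) b)
                          (sym (transpose-natural (p ↑ʳ_) (↑ʳ-injective p _ _) i j b))

toggle : ∀ {n} → Graph n → Fin n → Fin n → Graph n
toggle G k l = record
  { adj        = λ x y → edgeIs k l x y xor adj G x y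
  ; adj-sym    = λ x y → cong₂ _xor_ (edgeIs-sym k l x y) (Graph.adj-sym G x y)
  ; adj-irrefl = λ x → cong₂ _xor_ (edgeIs-irrefl k l x) (Graph.adj-irrefl G x)
  }

∨-as-xor : ∀ e a → (e ≡ true → a ≡ false) → e ∨ a ≡ e xor a
∨-as-xor false a _     = refl
∨-as-xor true  a e⇒¬a rewrite e⇒¬a refl = refl

∧-as-xor : ∀ e a → (e ≡ true → a ≡ true) → not e ∧ a ≡ e xor a
∧-as-xor false a _    = refl
∧-as-xor true  a e⇒a rewrite e⇒a refl = refl

addEdge-toggle : ∀ {n} (G : Graph n) {k l} → IsNonEdge G k l → addEdge G k l ≗G toggle G k l
addEdge-toggle G (_ , kl∉G) x y = ∨-as-xor _ _ (λ e → trans (on-pair G e) kl∉G)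

removeEdge-toggle : ∀ {n} (G : Graph n) {k l} → IsEdge G k l → removeEdge G k l ≗G toggle G k l
removeEdge-toggle G kl∈G x y = ∧-as-xor _ _ (λ e → trans (on-pair G e) kl∈G)

xor-cancel : ∀ e b → e xor (e xor b) ≡ b
xor-cancel false b = refl
xor-cancel true  b = not-involutive b

xor-exchange : ∀ a b c → a xor (b xor c) ≡ b xor (a xor c)
xor-exchange false b     c = refl
xor-exchange true  false c = refl
xor-exchange true  true  c = refl

xor-replace : ∀ a e f → (e ≡ true → f ≡ true) → (a ≡ true → f ≡ false) →
              a xor (e xor f) ≡ a ∨ (not e ∧ f)
xor-replace false false f _   _    = refl
xor-replace false true  f e⇒f _    rewrite e⇒f refl = refl
xor-replace true  false f _   a⇒¬f rewrite a⇒¬f refl = refl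
xor-replace true  true  f e⇒f a⇒¬f with trans (sym (e⇒f refl)) (a⇒¬f refl)
... | ()

toggle-replacement : ∀ {n} {F F′ : Graph n} {r s k l} → IsEdge F r s → IsNonEdge F k l →
                     (∀ x y → adj F′ x y ≡ edgeIs k l x y xor (edgeIs r s x y xor adj F x y)) →
                     F′ ≗G replace F r s k l
toggle-replacement {F = F} {r = r} {s} {k} {l} rs (_ , kl∉F) toggled x y =
  trans (toggled x y)
        (xor-replace (edgeIs k l x y) (edgeIs r s x y) (adj F x y) (λ e → trans (on-pair F e) rs) (λ e → trans (on-pair F e) kl∉F))

⊕-toggleˡ : ∀ {m n} (X : Graph m) (K : Graph n) k l x y →
            adj (toggle X k l ⊕ K) x y ≡ edgeIs (k ↑ˡ n) (l ↑ˡ n) x y xor adj (X ⊕ K) x y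
⊕-toggleˡ {m} {n} X K k l x y with side m n x | side m n y
... | left a  | left a′ =
  trans (⊕-adjˡˡ (toggle X k l) K a a′)
        (sym (cong₂ _xor_ (edgeIs-map (_↑ˡ n) (↑ˡ-injective n _ _) k l a a′) (⊕-adjˡˡ X K a a′)))
... | left a  | right b =
  trans (⊕-adjˡʳ (toggle X k l) K a b)
        (sym (cong₂ _xor_ (edgeIs-apartʳ (a ↑ˡ n) (λ e → ↑ˡ≢↑ʳ k b (sym e)) (λ e → ↑ˡ≢↑ʳ l b (sym e)))
                          (⊕-adjˡʳ X K a b)))
... | right b | left a  =
  trans (⊕-adjʳˡ (toggle X k l) K b a)
        (sym (cong₂ _xor_ (edgeIs-apartˡ (a ↑ˡ n) (λ e → ↑ˡ≢↑ʳ k b (sym e)) (λ e → ↑ˡ≢↑ʳ l b (sym e)))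
                          (⊕-adjʳˡ X K b a)))
... | right b | right b′ =
  trans (⊕-adjʳʳ (toggle X k l) K b b′)
        (sym (cong₂ _xor_ (edgeIs-apartˡ (m ↑ʳ b′) (λ e → ↑ˡ≢↑ʳ k b (sym e)) (λ e → ↑ˡ≢↑ʳ l b (sym e)))
                          (⊕-adjʳʳ X K b b′)))

⊕-toggleʳ : ∀ {m n} (X : Graph m) (K : Graph n) k l x y →
            adj (X ⊕ toggle K k l) x y ≡ edgeIs (m ↑ʳ k) (m ↑ʳ l) x y xor adj (X ⊕ K) x y
⊕-toggleʳ {m} {n} X K k l x y with side m n x | side m n y
... | left a  | left a′ =
  trans (⊕-adjˡˡ X (toggle K k l) a a′)
        (sym (cong₂ _xor_ (edgeIs-apartˡ (a′ ↑ˡ n) (↑ˡ≢↑ʳ a k) (↑ˡ≢↑ʳ a l)) (⊕-adjˡˡ X K a a′)))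
... | left a  | right b =
  trans (⊕-adjˡʳ X (toggle K k l) a b)
        (sym (cong₂ _xor_ (edgeIs-apartˡ (m ↑ʳ b) (↑ˡ≢↑ʳ a k) (↑ˡ≢↑ʳ a l)) (⊕-adjˡʳ X K a b)))
... | right b | left a  =
  trans (⊕-adjʳˡ X (toggle K k l) b a)
        (sym (cong₂ _xor_ (edgeIs-apartʳ (m ↑ʳ b) (↑ˡ≢↑ʳ a k) (↑ˡ≢↑ʳ a l)) (⊕-adjʳˡ X K b a)))
... | right b | right b′ =
  trans (⊕-adjʳʳ X (toggle K k l) b b′)
        (sym (cong₂ _xor_ (edgeIs-map (m ↑ʳ_) (↑ʳ-injective m _ _) k l b b′) (⊕-adjʳʳ X K b b′)))

-- The vertices of A ⊕ (B ⊕ C), with |A| = |B| = c and |C| = r, fall into three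
-- blocks; τ exchanges the first two.

module Blocks (c r : ℕ) where

  N : ℕ
  N = c + (c + r)

  i₁ i₂ : Fin c → Fin N
  i₁ a = a ↑ˡ (c + r)
  i₂ b = c ↑ʳ (b ↑ˡ r)

  i₃ : Fin r → Fin N
  i₃ z = c ↑ʳ (c ↑ʳ z)

  data Block : Fin N → Set where
    first  : ∀ a → Block (i₁ a)
    second : ∀ b → Block (i₂ b)
    third  : ∀ z → Block (i₃ z)

  block : ∀ x → Block x
  block x with side c (c + r) x
  ... | left a  = first a
  ... | right w with side c r w
  ...   | left b  = second b
  ...   | right z = third z

  i₁-injective : Injective _≡_ _≡_ i₁
  i₁-injective = ↑ˡ-injective (c + r) _ _

  i₂-injective : Injective _≡_ _≡_ i₂
  i₂-injective e = ↑ˡ-injective r _ _ (↑ʳ-injective c _ _ e)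

  i₁≢i₂ : ∀ a b → ¬ i₁ a ≡ i₂ b
  i₁≢i₂ a b = ↑ˡ≢↑ʳ a (b ↑ˡ r)

  i₁≢i₃ : ∀ a z → ¬ i₁ a ≡ i₃ z
  i₁≢i₃ a z = ↑ˡ≢↑ʳ a (c ↑ʳ z)

  blockAdj : (A B : Graph c) (C : Graph r) → ∀ {x y} → Block x → Block y → Bool
  blockAdj A B C (first a)  (first a′)  = adj A a a′
  blockAdj A B C (second b) (second b′) = adj B b b′
  blockAdj A B C (third z)  (third z′)  = adj C z z′
  blockAdj A B C _          _           = false

  adj-blocks : (A B : Graph c) (C : Graph r) → ∀ {x y} (bx : Block x) (by : Block y) →
               adj (A ⊕ (B ⊕ C)) x y ≡ blockAdj A B C bx by
  adj-blocks A B C (first a)  (first a′)  = ⊕-adjˡˡ A (B ⊕ C) a a′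
  adj-blocks A B C (first a)  (second b)  = ⊕-adjˡʳ A (B ⊕ C) a _
  adj-blocks A B C (first a)  (third z)   = ⊕-adjˡʳ A (B ⊕ C) a _
  adj-blocks A B C (second b) (first a)   = ⊕-adjʳˡ A (B ⊕ C) _ a
  adj-blocks A B C (second b) (second b′) = trans (⊕-adjʳʳ A (B ⊕ C) _ _) (⊕-adjˡˡ B C b b′)
  adj-blocks A B C (second b) (third z)   = trans (⊕-adjʳʳ A (B ⊕ C) _ _) (⊕-adjˡʳ B C b z)
  adj-blocks A B C (third z)  (first a)   = ⊕-adjʳˡ A (B ⊕ C) _ a
  adj-blocks A B C (third z)  (second b)  = trans (⊕-adjʳʳ A (B ⊕ C) _ _) (⊕-adjʳˡ B C z b)
  adj-blocks A B C (third z)  (third z′)  = trans (⊕-adjʳʳ A (B ⊕ C) _ _) (⊕-adjʳʳ B C z z′)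

  exchange : Fin N → Fin N
  exchange x = [ i₂ , (λ w → [ i₁ , i₃ ]′ (splitAt c w)) ]′ (splitAt c x)

  exchange-first : ∀ a → exchange (i₁ a) ≡ i₂ a
  exchange-first a rewrite splitAt-↑ˡ c a (c + r) = refl

  exchange-second : ∀ b → exchange (i₂ b) ≡ i₁ b
  exchange-second b rewrite splitAt-↑ʳ c (c + r) (b ↑ˡ r) | splitAt-↑ˡ c b r = refl

  exchange-third : ∀ z → exchange (i₃ z) ≡ i₃ z
  exchange-third z rewrite splitAt-↑ʳ c (c + r) (c ↑ʳ z) | splitAt-↑ʳ c r z = refl

  exchange-involutive : ∀ x → exchange (exchange x) ≡ x
  exchange-involutive x with block x
  ... | first a  = trans (cong exchange (exchange-first a)) (exchange-second a)
  ... | second b = trans (cong exchange (exchange-second b)) (exchange-first b)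
  ... | third z  = trans (cong exchange (exchange-third z)) (exchange-third z)

  τ : Permutation′ N
  τ = permutation exchange exchange exchange-involutive exchange-involutive

  module _ (A B : Graph c) (C : Graph r) where

    private
      via : ∀ {x y x′ y′} → exchange x ≡ x′ → exchange y ≡ y′ →
            (bx′ : Block x′) (by′ : Block y′) (bx : Block x) (by : Block y) →
            blockAdj A B C bx′ by′ ≡ blockAdj B A C bx by →
            adj (A ⊕ (B ⊕ C)) (exchange x) (exchange y) ≡ adj (B ⊕ (A ⊕ C)) x y
      via ex ey bx′ by′ bx by same =
        trans (cong₂ (adj (A ⊕ (B ⊕ C))) ex ey)
              (trans (adj-blocks A B C bx′ by′) (trans same (sym (adj-blocks B A C bx by))))

    swap-blocks : ∀ x y → adj (A ⊕ (B ⊕ C)) (τ ⟨$⟩ʳ x) (τ ⟨$⟩ʳ y) ≡ adj (B ⊕ (A ⊕ C)) x y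
    swap-blocks x y with block x | block y
    ... | first a  | first a′  = via (exchange-first a)  (exchange-first a′)  (second a) (second a′) (first a)  (first a′)  refl
    ... | first a  | second b  = via (exchange-first a)  (exchange-second b)  (second a) (first b)   (first a)  (second b)  refl
    ... | first a  | third z   = via (exchange-first a)  (exchange-third z)   (second a) (third z)   (first a)  (third z)   refl
    ... | second b | first a   = via (exchange-second b) (exchange-first a)   (first b)  (second a)  (second b) (first a)   refl
    ... | second b | second b′ = via (exchange-second b) (exchange-second b′) (first b)  (first b′)  (second b) (second b′) refl
    ... | second b | third z   = via (exchange-second b) (exchange-third z)   (first b)  (third z)   (second b) (third z)   refl
    ... | third z  | first a   = via (exchange-third z)  (exchange-first a)   (third z)  (second a)  (third z)  (first a)   refl
    ... | third z  | second b  = via (exchange-third z)  (exchange-second b)  (third z)  (first b)   (third z)  (second b)  refl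
    ... | third z  | third z′  = via (exchange-third z)  (exchange-third z′)  (third z)  (third z′)  (third z)  (third z′)  refl

-- The key generator: in (H ± kl) ⊕ (H ⊕ R) the block swap τ realises the
-- replacement of the pair kl in one copy of H by the pair kl in the other.

module _ {c r} (H : Graph c) (R : Graph r) {k l : Fin c} (k≢l : ¬ k ≡ l) where
  open Blocks c r

  private
    F F₀ : Graph N
    F  = toggle H k l ⊕ (H ⊕ R)
    F₀ = H ⊕ (H ⊕ R)

    E₁ E₂ : Fin N → Fin N → Bool
    E₁ = edgeIs (i₁ k) (i₁ l)
    E₂ = edgeIs (i₂ k) (i₂ l)

    first-pair : adj F (i₁ k) (i₁ l) ≡ not (adj H k l)
    first-pair = trans (⊕-adjˡˡ (toggle H k l) (H ⊕ R) k l) (cong (_xor adj H k l) (edgeIs-self k≢l))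

    second-pair : adj F (i₂ k) (i₂ l) ≡ adj H k l
    second-pair = trans (⊕-adjʳʳ (toggle H k l) (H ⊕ R) _ _) (⊕-adjˡˡ H R k l)

  -- F is F₀ toggled on the first copy of kl, its image under τ is F₀
  -- toggled on the second copy; so τ moves the first copy to the second.
  τ-toggles : ∀ x y → adj F (τ ⟨$⟩ʳ x) (τ ⟨$⟩ʳ y) ≡ E₂ x y xor (E₁ x y xor adj F x y)
  τ-toggles x y = begin
    adj F (τ ⟨$⟩ʳ x) (τ ⟨$⟩ʳ y)                        ≡⟨ swap-blocks (toggle H k l) H R x y ⟩
    adj (H ⊕ (toggle H k l ⊕ R)) x y                   ≡⟨ ⊕-≗ʳ H (⊕-toggleˡ H R k l) x y ⟩
    adj (H ⊕ toggle (H ⊕ R) (k ↑ˡ r) (l ↑ˡ r)) x y     ≡⟨ ⊕-toggleʳ H (H ⊕ R) (k ↑ˡ r) (l ↑ˡ r) x y ⟩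
    E₂ x y xor adj F₀ x y                              ≡⟨ cong (E₂ x y xor_) (xor-cancel (E₁ x y) (adj F₀ x y)) ⟨
    E₂ x y xor (E₁ x y xor (E₁ x y xor adj F₀ x y))    ≡⟨ cong (λ b → E₂ x y xor (E₁ x y xor b))
                                                             (⊕-toggleˡ H (H ⊕ R) k l x y) ⟨
    E₂ x y xor (E₁ x y xor adj F x y)                  ∎
    where open ≡-Reasoning

  swap-generator : Generator F τ
  swap-generator with adj H k l in kl∈H
  ... | false = generator {G = F} {τ} (i₁ k) (i₁ l) (i₂ k) (i₂ l) present (inj₁ absent)
                  (toggle-replacement {F = F} {F [ τ ]} present absent τ-toggles)
    where
    present : IsEdge F (i₁ k) (i₁ l)
    present = trans first-pair (cong not kl∈H)
    absent : IsNonEdge F (i₂ k) (i₂ l)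
    absent = (λ e → k≢l (i₂-injective e)) , trans second-pair kl∈H
  ... | true  = generator {G = F} {τ} (i₂ k) (i₂ l) (i₁ k) (i₁ l) present (inj₁ absent)
                  (toggle-replacement {F = F} {F [ τ ]} present absent
                     (λ x y → trans (τ-toggles x y) (xor-exchange (E₂ x y) (E₁ x y) (adj F x y))))
    where
    present : IsEdge F (i₂ k) (i₂ l)
    present = trans second-pair kl∈H
    absent : IsNonEdge F (i₁ k) (i₁ l)
    absent = (λ e → k≢l (i₁-injective e)) , trans first-pair (cong not kl∈H)

module _ {c r} (X H : Graph c) (R : Graph r) where
  open Blocks c r

  -- The transpositions inside blocks 2 and 3 come from the amoeba H ⊕ R;
  -- conjugating by τ yields those meeting block 1 and blocks 1, 3; and
  -- conjugating (i₁ a  i₃ z₀) by (i₃ z₀  i₂ b) yields those between blocks 1 and 2.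
  swap-amoeba : Fin r → LocalAmoeba (H ⊕ R) → Generator (X ⊕ (H ⊕ R)) τ → LocalAmoeba (X ⊕ (H ⊕ R))
  swap-amoeba z₀ amoeba τ-generator = generated-by-transpositions every
    where
    Γ : Permutation′ N → Set
    Γ = Generated (Generator (X ⊕ (H ⊕ R)))

    inner : ∀ u v → Γ (transpose (c ↑ʳ u) (c ↑ʳ v))
    inner u v = lift-transposition X (H ⊕ R) (amoeba (transpose u v))

    moved : ∀ u v {x y} → τ ⟨$⟩ʳ (c ↑ʳ u) ≡ x → τ ⟨$⟩ʳ (c ↑ʳ v) ≡ y → Γ (transpose x y)
    moved u v τu τv =
      subst₂ (λ x y → Γ (transpose x y)) τu τv (conjugate {σ = τ} (gen τ-generator) (inner u v))

    first-first : ∀ a a′ → Γ (transpose (i₁ a) (i₁ a′))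
    first-first a a′ = moved (a ↑ˡ r) (a′ ↑ˡ r) (exchange-second a) (exchange-second a′)

    first-third : ∀ a z → Γ (transpose (i₁ a) (i₃ z))
    first-third a z = moved (a ↑ˡ r) (c ↑ʳ z) (exchange-second a) (exchange-third z)

    first-second : ∀ a b → Γ (transpose (i₁ a) (i₂ b))
    first-second a b =
      subst₂ (λ x y → Γ (transpose x y))
             (transpose-away (i₁≢i₃ a z₀) (i₁≢i₂ a b)) (transpose-atˡ (i₃ z₀) (i₂ b))
             (conjugate (inner (c ↑ʳ z₀) (b ↑ˡ r)) (first-third a z₀))

    every : ∀ x y → Γ (transpose x y)
    every x y with block x | block y
    ... | first a  | first a′ = first-first a a′
    ... | first a  | second b = first-second a b
    ... | first a  | third z  = first-third a z
    ... | second b | first a  = transpose-flip (first-second a b)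
    ... | third z  | first a  = transpose-flip (first-third a z)
    ... | second _ | second _ = inner _ _
    ... | second _ | third _  = inner _ _
    ... | third _  | second _ = inner _ _
    ... | third _  | third _  = inner _ _

-- If G ∪ tK₁ is a local amoeba for t ≥ T, G ≅ H′ ∪ H″ and H ≅ H′, then
-- G ∪ X ∪ tK₁ is a local amoeba for t > T whenever X is H with the pair kl
-- toggled; the extra isolated vertex is the z₀ required by swap-amoeba.
toggle-global-amoeba : ∀ {n a b c} (G : Graph n) (H′ : Graph a) (H″ : Graph b) (H : Graph c) →
                       GlobalAmoeba G → Iso G (H′ ⊕ H″) → Iso H H′ →
                       ∀ {k l} → ¬ k ≡ l → (X : Graph c) → X ≗G toggle H k l → GlobalAmoeba (G ⊕ X)
toggle-global-amoeba G H′ H″ H (T , amoeba) G≃H′⊕H″ H≃H′ {k} {l} k≢l X X≗ =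
  suc T , λ { (suc t) (s≤s T≤t) →
    amoeba-transfer (rearranged (suc t))
      (swap-amoeba (toggle H k l) H (H″ ⊕ isolated (suc t)) (_ ↑ʳ fzero)
        (amoeba-transfer (≃-sym (base (suc t))) (amoeba (suc t) (m≤n⇒m≤1+n T≤t)))
        (swap-generator H (H″ ⊕ isolated (suc t)) k≢l)) }
  where
  base : ∀ t → Iso (G ⊕ isolated t) (H ⊕ (H″ ⊕ isolated t))
  base t =
    G ⊕ I               ≃⟨ ⊕-cong G≃H′⊕H″ (I ≃∎) ⟩
    (H′ ⊕ H″) ⊕ I       ≃⟨ ⊕-cong (⊕-cong (≃-sym H≃H′) (H″ ≃∎)) (I ≃∎) ⟩
    (H ⊕ H″) ⊕ I        ≃⟨ ⊕-assoc H H″ I ⟩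
    H ⊕ (H″ ⊕ I)        ≃∎
    where
    I : Graph t
    I = isolated t
  rearranged : ∀ t → Iso ((G ⊕ X) ⊕ isolated t) (toggle H k l ⊕ (H ⊕ (H″ ⊕ isolated t)))
  rearranged t =
    (G ⊕ X) ⊕ I               ≃⟨ ⊕-cong (⊕-comm G X) (I ≃∎) ⟩
    (X ⊕ G) ⊕ I               ≃⟨ ⊕-assoc X G I ⟩
    X ⊕ (G ⊕ I)               ≃⟨ ⊕-cong (≗⇒Iso X≗) (base t) ⟩
    toggle H k l ⊕ (H ⊕ (H″ ⊕ I)) ≃∎
    where
    I : Graph t
    I = isolated t

theorem4p4 : ∀ {n a b c} (G : Graph n) (H′ : Graph a) (H″ : Graph b) (H : Graph c)
               → GlobalAmoeba G
               → G ≅ (H′ ⊕ H″)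
               → H ≅ H′
               → (∀ (k l : Fin c) → IsNonEdge H k l → GlobalAmoeba (G ⊕ addEdge H k l))
                 × (∀ (k l : Fin c) → IsEdge H k l → GlobalAmoeba (G ⊕ removeEdge H k l))
theorem4p4 {c = c} G H′ H″ H amoeba G≅H′⊕H″ H≅H′ = part-i , part-ii
  where
  -- both H + kl (kl absent) and H − kl (kl present) are H with kl toggled
  toggled : ∀ {k l} → ¬ k ≡ l → (X : Graph c) → X ≗G toggle H k l → GlobalAmoeba (G ⊕ X)
  toggled = toggle-global-amoeba G H′ H″ H amoeba (≅⇒Iso G≅H′⊕H″) (≅⇒Iso H≅H′)
  part-i : ∀ k l → IsNonEdge H k l → GlobalAmoeba (G ⊕ addEdge H k l)
  part-i k l kl∉H = toggled (proj₁ kl∉H) (addEdge H k l) (addEdge-toggle H kl∉H)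
  part-ii : ∀ k l → IsEdge H k l → GlobalAmoeba (G ⊕ removeEdge H k l)
  part-ii k l kl∈H = toggled (edge-ends-distinct H kl∈H) (removeEdge H k l) (removeEdge-toggle H kl∈H)
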